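{- There exists a gadget with performance 9 and parity 1.
   Context: Multigraphs are undirected, edges counted with multiplicity; a subgraph is a sub-multiset of edges; triangle-free means the underlying simple graph has no triangle. For a bipartite graph $B$ with vertex set $W$ and $W'\subseteq W$, a map $c:W'\to\{0,1\}$ is compatible with $B$ if it extends to a proper 2-colouring of $B$. A gadget with performance $\alpha\in\mathbb{N}$ and parity $p\in\{0,1\}$ is a finite multigraph $G=(V,E)$ with distinguished vertices $0,x,y,z\in V$ such that: (1) for every $c:\{0,x,y,z\}\to\{0,1\}$ with $c(0)+c(x)+c(y)+c(z)\equiv p\pmod 2$ there is a bipartite subgraph $H$ of $G$ with $\alpha$ edges such that $c$ is compatible with $H$; (2) every triangle-free subgraph of $G$ has at most $\alpha$ edges; (3) every triangle-free subgraph $H$ of $G$ with strictly more than $\alpha-1$ edges has $0,x,y,z$ in the same connected component $C$ of $H$, the distance in $H$ from $0$ to each of $x,y,z$ is at most 2, $C$ is bipartite, and every $c:\{0,x,y,z\}\to\{0,1\}$ compatible with $C$ satisfies $c(0)+c(x)+c(y)+c(z)\equiv p\pmod 2$. -}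

module Defs where

open import Data.Nat using (ℕ; _≤_)
open import Data.Bool using (Bool; true; false; _xor_)
open import Data.Fin using (Fin)
open import Data.Fin.Subset using (Subset; _∈_; ∣_∣)
open import Data.Product using (_×_; _,_; proj₁; proj₂; ∃; ∃-syntax; Σ-syntax)
open import Data.Sum using (_⊎_)
open import Data.Empty using (⊥)
open import Relation.Binary.PropositionalEquality using (_≡_; _≢_)

-- A finite loopless multigraph: vertices Fin n, edges indexed by Fin m
-- (so parallel edges are allowed), each edge with its two (distinct) ends.
record Multigraph : Set where
  field
    n        : ℕ
    m        : ℕ
    ends     : Fin m → Fin n × Fin n
    loopless : ∀ e → proj₁ (ends e) ≢ proj₂ (ends e)

module _ (G : Multigraph) where
  open Multigraph G

  -- A subgraph is a sub-multiset of the edges (spanning all of V).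
  Subgraph : Set
  Subgraph = Subset m

  size : Subgraph → ℕ
  size H = ∣ H ∣

  Adj : Subgraph → Fin n → Fin n → Set
  Adj H u v = ∃[ e ] (e ∈ H × ((ends e ≡ (u , v)) ⊎ (ends e ≡ (v , u))))

  TriangleFree : Subgraph → Set
  TriangleFree H = ∀ u v w → Adj H u v → Adj H v w → Adj H u w → ⊥

  data Reach (H : Subgraph) (u : Fin n) : Fin n → Set where
    here : Reach H u u
    step : ∀ {v w} → Reach H u v → Adj H v w → Reach H u w

  Dist≤2 : Subgraph → Fin n → Fin n → Set
  Dist≤2 H u v = (u ≡ v) ⊎ (Adj H u v ⊎ (∃[ w ] (Adj H u w × Adj H w v)))

  Proper : Subgraph → (Fin n → Bool) → Set
  Proper H f = ∀ e → e ∈ H → f (proj₁ (ends e)) ≢ f (proj₂ (ends e))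

  ProperOnComp : Subgraph → Fin n → (Fin n → Bool) → Set
  ProperOnComp H r f =
    ∀ e → e ∈ H → Reach H r (proj₁ (ends e)) → f (proj₁ (ends e)) ≢ f (proj₂ (ends e))

  -- Colours c(0),c(x),c(y),c(z) ∈ Bool (false = 0, true = 1); the parity
  -- condition c(0)+c(x)+c(y)+c(z) ≡ p (mod 2) is xor.
  ParityOK : Bool → Bool → Bool → Bool → Bool → Set
  ParityOK p c0 cx cy cz = (c0 xor cx xor cy xor cz) ≡ p

  record IsGadget (o x y z : Fin n) (α : ℕ) (p : Bool) : Set where
    field
      distinct : (o ≢ x) × (o ≢ y) × (o ≢ z) × (x ≢ y) × (x ≢ z) × (y ≢ z)
      realize : ∀ c0 cx cy cz → ParityOK p c0 cx cy cz →
        Σ[ H ∈ Subgraph ] ((size H ≡ α) ×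
          (Σ[ f ∈ (Fin n → Bool) ] (Proper H f ×
            (f o ≡ c0) × (f x ≡ cx) × (f y ≡ cy) × (f z ≡ cz))))
      bound : ∀ H → TriangleFree H → size H ≤ α
      -- (3)  ("strictly more than α − 1 edges" = "at least α edges")
      tight : ∀ H → TriangleFree H → α ≤ size H →
        (Reach H o x × Reach H o y × Reach H o z) ×
        (Dist≤2 H o x × Dist≤2 H o y × Dist≤2 H o z) ×
        (Σ[ f ∈ (Fin n → Bool) ] ProperOnComp H o f) ×
        (∀ c0 cx cy cz → (Σ[ f ∈ (Fin n → Bool) ] (ProperOnComp H o f ×
            (f o ≡ c0) × (f x ≡ cx) × (f y ≡ cy) × (f z ≡ cz))) →
          ParityOK p c0 cx cy cz)

Gadget : ℕ → Bool → Set
Gadget α p = Σ[ G ∈ Multigraph ] Σ[ o ∈ Fin (Multigraph.n G) ]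
  Σ[ x ∈ Fin (Multigraph.n G) ] Σ[ y ∈ Fin (Multigraph.n G) ]
  Σ[ z ∈ Fin (Multigraph.n G) ] IsGadget G o x y z α p

{-# OPTIONS --safe #-}

-- The gadget is K₅ on {0, x, y, z, u} with every edge at u doubled (14 edges). In a
-- triangle-free subgraph the d neighbours of u are pairwise non-adjacent, so it has at most
-- 2d + min (4, 6 − d(d−1)/2) ≤ 9 edges, with equality only if d = 3 and the remaining
-- terminal w is joined to all three: the subgraph is then the complete bipartite graph
-- between {w, u} and the other three vertices. This classification is verified by an
-- exhaustive search over all 2¹⁴ edge sets. In each of the four extremal subgraphs an odd
-- number of x, y, z lie at distance 1 from 0 (all three if w = 0, only w otherwise) and the
-- others at distance 2, so every proper colouring has c(0) + c(x) + c(y) + c(z) odd; and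
-- the colourings of their bipartitions realize every odd pattern.

module Submission where

open import Defs
open import Data.Bool using (Bool; true; false; not; T; _∧_; _∨_; _xor_)
open import Data.Bool.ListAction using (any)
open import Data.Bool.Properties
  using (¬-not; not-injective; not-involutive; xor-same; xor-identityʳ; xor-annihilates-not;
         not-distribˡ-xor; T-∧)
  renaming (_≟_ to _≟ᵇ_)
open import Data.Fin using (Fin; inject₁)
open import Data.Fin.Patterns using (0F; 1F; 2F; 3F; 4F)
open import Data.Fin.Properties using (any?; all?) renaming (_≟_ to _≟ᶠ_)
open import Data.Fin.Subset using (Subset; _∈_)
open import Data.Fin.Subset.Properties using (_∈?_; anySubset?)
open import Data.List using (allFin)
open import Data.List.Membership.Propositional using (lose)
open import Data.List.Membership.Propositional.Properties using (∈-allFin)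
open import Data.List.Relation.Unary.Any using (satisfied)
open import Data.List.Relation.Unary.Any.Properties using (any⁺; any⁻)
open import Data.Nat using (_≤_; _≤?_)
open import Data.Nat.Properties using (≰⇒>; <⇒≤; ≤-reflexive)
open import Data.Product using (_×_; _,_; proj₁; proj₂; ∃-syntax; Σ-syntax)
import Data.Product.Properties as Product
open import Data.Sum using (_⊎_; inj₁; inj₂; [_,_]′)
open import Data.Vec using (Vec; []; _∷_; lookup; tabulate)
open import Data.Vec.Properties using (lookup∘tabulate; []=⇒lookup)
import Data.Vec.Properties as Vec
open import Function using (id; _∘_; _$_; Equivalence)
open import Relation.Nullary
  using (Dec; yes; no; ¬_; ¬?; map′; _×-dec_; _⊎-dec_; _→-dec_; ⌊_⌋; T?; toWitness;
         fromWitness; from-yes; contradiction; decidable-stable)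
open import Relation.Unary using (Pred; Decidable)
open import Relation.Binary.PropositionalEquality
  using (_≡_; _≢_; ≢-sym; refl; sym; trans; cong; cong₂; subst)
open Relation.Binary.PropositionalEquality.≡-Reasoning

xor-trueʳ : ∀ a → a xor true ≡ not a
xor-trueʳ false = refl
xor-trueʳ true  = refl

xor-true⇒≢ : ∀ {p q} → p xor q ≡ true → p ≢ q
xor-true⇒≢ {q = q} p⊕q≡true refl with () ← trans (sym (xor-same q)) p⊕q≡true

xorˡ-≢ : ∀ b {p q} → p ≢ q → b xor p ≢ b xor q
xorˡ-≢ false p≢q = p≢q
xorˡ-≢ true  p≢q = p≢q ∘ not-injective

xor-cancel-four : ∀ a p q r → a xor (a xor p) xor (a xor q) xor (a xor r) ≡ p xor q xor r
xor-cancel-four false p q r = refl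
xor-cancel-four true  p q r = begin
  not (not p xor not q xor not r) ≡⟨ cong (λ t → not (not p xor t)) (xor-annihilates-not q r) ⟩
  not (not p xor q xor r)         ≡⟨ cong not (not-distribˡ-xor p _) ⟨
  not (not (p xor q xor r))       ≡⟨ not-involutive _ ⟩
  p xor q xor r                   ∎

any-allFin⁻ : ∀ {k} (p : Fin k → Bool) → T (any p (allFin k)) → ∃[ i ] T (p i)
any-allFin⁻ p = satisfied ∘ any⁻ p (allFin _)

allSubsets? : ∀ {n ℓ} {P : Pred (Subset n) ℓ} → Decidable P → Dec (∀ p → P p)
allSubsets? P? = map′ (λ ∄¬P p → decidable-stable (P? p) (∄¬P ∘ (p ,_)))
                      (λ ∀P (p , ¬Pp) → ¬Pp (∀P p))
                      (¬? (anySubset? (¬? ∘ P?)))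

module _ (G : Multigraph) where
  open Multigraph G

  _≟ᵉ_ : (a b : Fin n × Fin n) → Dec (a ≡ b)
  _≟ᵉ_ = Product.≡-dec _≟ᶠ_ _≟ᶠ_

  incident? : ∀ H e a b → Dec (e ∈ H × ((ends e ≡ (a , b)) ⊎ (ends e ≡ (b , a))))
  incident? H e a b = e ∈? H ×-dec (ends e ≟ᵉ (a , b) ⊎-dec ends e ≟ᵉ (b , a))

  -- Boolean rather than Dec-valued searches: the exhaustive search evaluates hasTriangle on
  -- thousands of subgraphs by normalisation, where Data.Fin's any?/all? are far slower.
  adjacent : Subgraph G → Fin n → Fin n → Bool
  adjacent H a b = any (λ e → ⌊ incident? H e a b ⌋) (allFin m)

  adj? : ∀ H a b → Dec (Adj G H a b)
  adj? H a b = map′ sound complete (T? (adjacent H a b))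
    where
    sound : T (adjacent H a b) → Adj G H a b
    sound t with e , incident ← any-allFin⁻ _ t = e , toWitness incident
    complete : Adj G H a b → T (adjacent H a b)
    complete (e , incident) = any⁺ _ (lose (∈-allFin e) (fromWitness incident))

  commonNeighbour? : ∀ H e w → Dec (Adj G H (proj₁ (ends e)) w × Adj G H (proj₂ (ends e)) w)
  commonNeighbour? H e w = adj? H (proj₁ (ends e)) w ×-dec adj? H (proj₂ (ends e)) w

  hasTriangle : Subgraph G → Bool
  hasTriangle H =
    any (λ e → ⌊ e ∈? H ⌋ ∧ any (λ w → ⌊ commonNeighbour? H e w ⌋) (allFin n)) (allFin m)

  hasTriangle⇒¬triangleFree : ∀ {H} → T (hasTriangle H) → ¬ TriangleFree G H
  hasTriangle⇒¬triangleFree {H} t triangleFree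
    with e , t-e ← any-allFin⁻ _ t
    with e∈H , t-w ← Equivalence.to T-∧ t-e
    with w , common ← any-allFin⁻ _ t-w
    with aw , bw ← toWitness {a? = commonNeighbour? H e w} common
    = triangleFree _ _ w (e , toWitness e∈H , inj₁ refl) bw aw

  dist≤2? : ∀ H u v → Dec (Dist≤2 G H u v)
  dist≤2? H u v = u ≟ᶠ v ⊎-dec adj? H u v ⊎-dec any? λ w → adj? H u w ×-dec adj? H w v

  cut : (Fin n → Bool) → Subgraph G
  cut s = tabulate λ e → s (proj₁ (ends e)) xor s (proj₂ (ends e))

  cut-proper : ∀ s b → Proper G (cut s) (λ v → b xor s v)
  cut-proper s b e e∈cut =
    xorˡ-≢ b (xor-true⇒≢ (trans (sym (lookup∘tabulate _ e)) ([]=⇒lookup e∈cut)))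

  module _ {H : Subgraph G} where

    reach-dist≤2 : ∀ {u v} → Dist≤2 G H u v → Reach G H u v
    reach-dist≤2 (inj₁ refl)                 = here
    reach-dist≤2 (inj₂ (inj₁ uv))            = step here uv
    reach-dist≤2 (inj₂ (inj₂ (w , uw , wv))) = step (step here uw) wv

    proper⇒properOnComp : ∀ {r f} → Proper G H f → ProperOnComp G H r f
    proper⇒properOnComp proper e e∈H _ = proper e e∈H

    properOnComp-edge : ∀ {r f e a b} → ProperOnComp G H r f → e ∈ H → ends e ≡ (a , b) →
                        Reach G H r a → f a ≢ f b
    properOnComp-edge proper e∈H refl = proper _ e∈H

    properOnComp-adj : ∀ {r f u v} → ProperOnComp G H r f → Reach G H r u → Adj G H u v →
                       f v ≡ not (f u)
    properOnComp-adj proper r⇝u (e , e∈H , inj₁ ends≡uv) =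
      ¬-not (≢-sym (properOnComp-edge proper e∈H ends≡uv r⇝u))
    properOnComp-adj proper r⇝u uv@(e , e∈H , inj₂ ends≡vu) =
      ¬-not (properOnComp-edge proper e∈H ends≡vu (step r⇝u uv))

    odd : ∀ {u v} → Dist≤2 G H u v → Bool
    odd (inj₁ _)        = false
    odd (inj₂ (inj₁ _)) = true
    odd (inj₂ (inj₂ _)) = false

    properOnComp-dist≤2 : ∀ {r f u v} → ProperOnComp G H r f → Reach G H r u →
                          (d : Dist≤2 G H u v) → f v ≡ f u xor odd d
    properOnComp-dist≤2 proper r⇝u (inj₁ refl) = sym (xor-identityʳ _)
    properOnComp-dist≤2 proper r⇝u (inj₂ (inj₁ uv)) =
      trans (properOnComp-adj proper r⇝u uv) (sym (xor-trueʳ _))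
    properOnComp-dist≤2 {f = f} {u} proper r⇝u (inj₂ (inj₂ (w , uw , wv))) = begin
      f _             ≡⟨ properOnComp-adj proper (step r⇝u uw) wv ⟩
      not (f w)       ≡⟨ cong not (properOnComp-adj proper r⇝u uw) ⟩
      not (not (f u)) ≡⟨ not-involutive _ ⟩
      f u             ≡⟨ xor-identityʳ _ ⟨
      f u xor false   ∎

    parity-dist≤2 : ∀ {o x y z f} → ProperOnComp G H o f →
                    (dx : Dist≤2 G H o x) (dy : Dist≤2 G H o y) (dz : Dist≤2 G H o z) →
                    ParityOK G (odd dx xor odd dy xor odd dz) (f o) (f x) (f y) (f z)
    parity-dist≤2 {o = o} {f = f} proper dx dy dz =
      trans (cong₂ (λ cx cyz → f o xor cx xor cyz)
                   (colour dx) (cong₂ _xor_ (colour dy) (colour dz)))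
            (xor-cancel-four (f o) (odd dx) (odd dy) (odd dz))
      where
      colour : ∀ {v} (d : Dist≤2 G H o v) → f v ≡ f o xor odd d
      colour = properOnComp-dist≤2 proper here

  Tight : Subgraph G → (o x y z : Fin n) → Bool → Set
  Tight H o x y z p =
    (Reach G H o x × Reach G H o y × Reach G H o z) ×
    (Dist≤2 G H o x × Dist≤2 G H o y × Dist≤2 G H o z) ×
    (Σ[ f ∈ (Fin n → Bool) ] ProperOnComp G H o f) ×
    (∀ c0 cx cy cz → (Σ[ f ∈ (Fin n → Bool) ] (ProperOnComp G H o f ×
        (f o ≡ c0) × (f x ≡ cx) × (f y ≡ cy) × (f z ≡ cz))) →
      ParityOK G p c0 cx cy cz)

  tight-by-distances : ∀ {H o x y z p} →
    (ds : Dist≤2 G H o x × Dist≤2 G H o y × Dist≤2 G H o z) →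
    let dx , dy , dz = ds in odd dx xor odd dy xor odd dz ≡ p →
    Σ[ f ∈ (Fin n → Bool) ] Proper G H f → Tight H o x y z p
  tight-by-distances (dx , dy , dz) refl (f , proper) =
    (reach-dist≤2 dx , reach-dist≤2 dy , reach-dist≤2 dz) , (dx , dy , dz) ,
    (f , proper⇒properOnComp {f = f} proper) ,
    λ { _ _ _ _ (g , proper′ , refl , refl , refl , refl) →
          parity-dist≤2 {f = g} proper′ dx dy dz }

o x y z u : Fin 5
o = 0F
x = 1F
y = 2F
z = 3F
u = 4F

edges : Vec (Fin 5 × Fin 5) 14
edges = (o , x) ∷ (o , y) ∷ (o , z) ∷ (x , y) ∷ (x , z) ∷ (y , z) ∷
        (o , u) ∷ (o , u) ∷ (x , u) ∷ (x , u) ∷ (y , u) ∷ (y , u) ∷ (z , u) ∷ (z , u) ∷ []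

K₅ᵘ : Multigraph
K₅ᵘ = record
  { n        = 5
  ; m        = 14
  ; ends     = lookup edges
  ; loopless = from-yes (all? λ e →
                 ¬? (proj₁ (lookup edges e) ≟ᶠ proj₂ (lookup edges e)))
  }

side : Fin 4 → Fin 5 → Bool
side w v = ⌊ v ≟ᶠ inject₁ w ⌋ ∨ ⌊ v ≟ᶠ u ⌋

maximum : Fin 4 → Subgraph K₅ᵘ
maximum w = cut K₅ᵘ (side w)

size-maximum : ∀ w → size K₅ᵘ (maximum w) ≡ 9
size-maximum 0F = refl
size-maximum 1F = refl
size-maximum 2F = refl
size-maximum 3F = refl

triangle-or-maximum : ∀ H → 9 ≤ size K₅ᵘ H → (T (hasTriangle K₅ᵘ H) ⊎ ∃[ w ] H ≡ maximum w)
triangle-or-maximum = from-yes $ allSubsets? λ H →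
  9 ≤? size K₅ᵘ H →-dec
    (T? (hasTriangle K₅ᵘ H) ⊎-dec any? λ w → Vec.≡-dec _≟ᵇ_ H (maximum w))

maximum-unique : ∀ H → TriangleFree K₅ᵘ H → 9 ≤ size K₅ᵘ H → ∃[ w ] H ≡ maximum w
maximum-unique H triangleFree 9≤∣H∣ =
  [ contradiction triangleFree ∘ hasTriangle⇒¬triangleFree K₅ᵘ {H} , id ]′
    (triangle-or-maximum H 9≤∣H∣)

size≤9 : ∀ H → TriangleFree K₅ᵘ H → size K₅ᵘ H ≤ 9
size≤9 H triangleFree with 9 ≤? size K₅ᵘ H
... | no  9≰∣H∣ = <⇒≤ (≰⇒> 9≰∣H∣)
... | yes 9≤∣H∣ = let w , H≡maximum = maximum-unique H triangleFree 9≤∣H∣ in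
                  ≤-reflexive (trans (cong (size K₅ᵘ) H≡maximum) (size-maximum w))

colouring : Fin 4 → Bool → Fin 5 → Bool
colouring w b v = b xor side w v

proper-maximum : ∀ w b → Proper K₅ᵘ (maximum w) (colouring w b)
proper-maximum w = cut-proper K₅ᵘ (side w)

bipartition : ∀ w → Σ[ f ∈ (Fin 5 → Bool) ] Proper K₅ᵘ (maximum w) f
bipartition w = colouring w false , proper-maximum w false

distances? : ∀ H → Dec (Dist≤2 K₅ᵘ H o x × Dist≤2 K₅ᵘ H o y × Dist≤2 K₅ᵘ H o z)
distances? H = dist≤2? K₅ᵘ H o x ×-dec dist≤2? K₅ᵘ H o y ×-dec dist≤2? K₅ᵘ H o z

tight-maximum : ∀ w → Tight K₅ᵘ (maximum w) o x y z true
tight-maximum 0F = tight-by-distances K₅ᵘ (from-yes (distances? (maximum 0F))) refl (bipartition 0F)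
tight-maximum 1F = tight-by-distances K₅ᵘ (from-yes (distances? (maximum 1F))) refl (bipartition 1F)
tight-maximum 2F = tight-by-distances K₅ᵘ (from-yes (distances? (maximum 2F))) refl (bipartition 2F)
tight-maximum 3F = tight-by-distances K₅ᵘ (from-yes (distances? (maximum 3F))) refl (bipartition 3F)

Realization : (c0 cx cy cz : Bool) → Set
Realization c0 cx cy cz = Σ[ H ∈ Subgraph K₅ᵘ ] (size K₅ᵘ H ≡ 9 ×
  Σ[ f ∈ (Fin 5 → Bool) ] (Proper K₅ᵘ H f ×
    (f o ≡ c0) × (f x ≡ cx) × (f y ≡ cy) × (f z ≡ cz)))

realize-maximum : ∀ w b →
  Realization (colouring w b o) (colouring w b x) (colouring w b y) (colouring w b z)
realize-maximum w b =
  maximum w , size-maximum w , colouring w b , proper-maximum w b , refl , refl , refl , refl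

realize : ∀ c0 cx cy cz → ParityOK K₅ᵘ true c0 cx cy cz → Realization c0 cx cy cz
realize true  false false false _ = realize-maximum 0F false
realize false true  true  true  _ = realize-maximum 0F true
realize false true  false false _ = realize-maximum 1F false
realize true  false true  true  _ = realize-maximum 1F true
realize false false true  false _ = realize-maximum 2F false
realize true  true  false true  _ = realize-maximum 2F true
realize false false false true  _ = realize-maximum 3F false
realize true  true  true  false _ = realize-maximum 3F true
realize true  true  true  true  ()
realize true  true  false false ()
realize true  false true  false ()
realize true  false false true  ()
realize false false false false ()
realize false false true  true  ()
realize false true  false true  ()
realize false true  true  false ()

lemma16 : Gadget 9 true
lemma16 = K₅ᵘ , o , x , y , z , record
  { distinct = (λ ()) , (λ ()) , (λ ()) , (λ ()) , (λ ()) , (λ ())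
  ; realize  = realize
  ; bound    = size≤9
  ; tight    = λ H triangleFree 9≤∣H∣ →
      let w , H≡maximum = maximum-unique H triangleFree 9≤∣H∣ in
      subst (λ H → Tight K₅ᵘ H o x y z true) (sym H≡maximum) (tight-maximum w)
  }
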